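{- Let $n\ge 2$, let $\mathcal{C}_1 = \mathcal{C}(I^1_1,g^1),\ldots,\mathcal{C}_n=\mathcal{C}(I^n_1,g^n)$ be hole-decreasing Cantor sets and $x_1,\ldots,x_n \ge 0$ real numbers with $\mathrm{dr}_{\mathcal{C}_j} \ge x_j$ for all $j$, $\sum_{j=1}^n \frac{x_j}{x_j+1} \ge 1$, and $|I^j_1| \ge \frac{x_j}{x_j+1}(x_k+1)|I^k_1|$ for all $j,k$. Let $I^1_{i_1}, \ldots, I^n_{i_n}$ be comparable intervals. If $j$ is such that $(x_j+1)|g^j(I^j_{i_j})| \ge (x_k+1)|g^k(I^k_{i_k})|$ for all $k$, then $I^1_{i_1},\ldots,I^n_{i_n}$ are $j$-dividable.
   Context: For an interval $I$ with endpoints $a<b$ write $|I| = b-a$. A Cantor set $\mathcal{C}(I_1, g)$ is given by a closed interval $I_1$ of positive length and a gap function $g$: recursively, for every constructed interval $I_i$, $g(I_i)$ is an open subinterval of $I_i$ with $I_i = I_{2i} \cup g(I_i) \cup I_{2i+1}$ disjointly, $I_{2i}, I_{2i+1}$ closed intervals of positive length left and right of the gap; the set is $I_1 \setminus \bigcup_i g(I_i)$. The density ratio is $\mathrm{dr} = \inf_i \min(|I_{2i}|,|I_{2i+1}|)/|g(I_i)|$. It is hole-decreasing if $|g(I_{2i})| \le |g(I_i)|$ and $|g(I_{2i+1})| \le |g(I_i)|$ for all $i$. Here $I^j_m$ denotes the intervals in the construction of $\mathcal{C}_j$. Intervals $I^1_{i_1},\ldots,I^n_{i_n}$ are called comparable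 if for all $j,k$: $|I^j_{i_j}| \ge \frac{x_j}{x_j+1}(x_k+1)\,|g^k(I^k_{i_k})|$. Comparable intervals are $j$-dividable if both tuples obtained by replacing $I^j_{i_j}$ by $I^j_{2i_j}$, respectively by $I^j_{2i_j+1}$ (keeping the other entries), are again comparable. -}

module Defs where

open import Data.Nat as ℕ using (ℕ; zero; suc)
open import Data.Fin using (Fin; _≟_)
import Data.Fin as Fin
open import Data.Product using (_×_)
open import Data.Bool using (if_then_else_)
open import Relation.Nullary using (¬_; does)
open import Relation.Binary.PropositionalEquality using (_≡_)
open import Algebra.Core using (Op₁; Op₂)
open import Algebra.Structures using (IsCommutativeRing)
open import Relation.Binary.Structures using (IsTotalOrder)

-- An ordered field (axiomatised abstractly, since agda-stdlib has no reals).
-- The inverse is total; its value at 0# is unconstrained.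
record OrderedField : Set₁ where
  infixl 6 _+_ _-_
  infixl 7 _*_
  infix 4 _≤_ _<_
  field
    Carrier : Set
    _+_ _*_ : Op₂ Carrier
    -_ : Op₁ Carrier
    0# 1# : Carrier
    _⁻¹ : Op₁ Carrier
    _≤_ : Carrier → Carrier → Set
    isCommutativeRing : IsCommutativeRing _≡_ _+_ _*_ -_ 0# 1#
    0≢1 : ¬ (0# ≡ 1#)
    *-inverse : ∀ a → ¬ (a ≡ 0#) → a * (a ⁻¹) ≡ 1#
    isTotalOrder : IsTotalOrder _≡_ _≤_
    +-mono-≤ : ∀ {a b} c → a ≤ b → a + c ≤ b + c
    *-nonneg : ∀ {a b} → 0# ≤ a → 0# ≤ b → 0# ≤ a * b

  _-_ : Op₂ Carrier
  a - b = a + (- b)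

  _<_ : Carrier → Carrier → Set
  a < b = (a ≤ b) × ¬ (a ≡ b)

module OF (F : OrderedField) where
  open OrderedField F public

  -- Cantor set C(I_1, g): interval I_i = [left i, right i], gap g(I_i) = (gapL i, gapR i),
  -- indices i ≥ 1, children I_{2i} (left), I_{2i+1} (right).
  record CantorSet : Set where
    field
      left right gapL gapR : ℕ → Carrier
      ordered : ∀ i → 1 ℕ.≤ i → (left i < gapL i) × (gapL i < gapR i) × (gapR i < right i)
      childL : ∀ i → 1 ℕ.≤ i → (left (2 ℕ.* i) ≡ left i) × (right (2 ℕ.* i) ≡ gapL i)
      childR : ∀ i → 1 ℕ.≤ i → (left (suc (2 ℕ.* i)) ≡ gapR i) × (right (suc (2 ℕ.* i)) ≡ right i)

    len : ℕ → Carrier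
    len i = right i - left i

    gapLen : ℕ → Carrier
    gapLen i = gapR i - gapL i

  open CantorSet public

  HoleDecreasing : CantorSet → Set
  HoleDecreasing C = ∀ i → 1 ℕ.≤ i →
    (gapLen C (2 ℕ.* i) ≤ gapLen C i) × (gapLen C (suc (2 ℕ.* i)) ≤ gapLen C i)

  -- dr_C ≥ x, i.e. x ≤ inf_i min(|I_2i|,|I_2i+1|)/|g(I_i)|, i.e. x is ≤ every such ratio.
  DrAtLeast : CantorSet → Carrier → Set
  DrAtLeast C x = ∀ i → 1 ℕ.≤ i →
    (x ≤ len C (2 ℕ.* i) * (gapLen C i ⁻¹)) × (x ≤ len C (suc (2 ℕ.* i)) * (gapLen C i ⁻¹))

  frac : Carrier → Carrier
  frac x = x * ((x + 1#) ⁻¹)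

  sumFin : (n : ℕ) → (Fin n → Carrier) → Carrier
  sumFin zero f = 0#
  sumFin (suc n) f = f Fin.zero + sumFin n (λ k → f (Fin.suc k))

  Comparable : {n : ℕ} → (Fin n → CantorSet) → (Fin n → Carrier) → (Fin n → ℕ) → Set
  Comparable C x idx = ∀ j k →
    frac (x j) * (x k + 1#) * gapLen (C k) (idx k) ≤ len (C j) (idx j)

  update : {n : ℕ} → (Fin n → ℕ) → Fin n → ℕ → (Fin n → ℕ)
  update idx j m k = if does (k ≟ j) then m else idx k

  Dividable : {n : ℕ} → (Fin n → CantorSet) → (Fin n → Carrier) → (Fin n → ℕ) → Fin n → Set
  Dividable C x idx j =
    Comparable C x (update idx j (2 ℕ.* idx j)) × Comparable C x (update idx j (suc (2 ℕ.* idx j)))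

{-# OPTIONS --safe #-}
module Submission where

open import Defs
open import Data.Nat as ℕ using (ℕ)
open import Data.Fin using (Fin; _≟_)
open import Data.Product using (_×_; _,_; proj₁; proj₂)
import Data.Product as Product
open import Data.Sum using (inj₁; inj₂)
open import Relation.Nullary using (yes; no)
open import Relation.Binary.PropositionalEquality using (_≡_; _≢_; refl; sym; cong)
open import Relation.Binary.Bundles using (Poset)
open import Relation.Binary.Structures using (IsTotalOrder)
open import Algebra.Bundles using (CommutativeRing)
import Algebra.Properties.Ring as RingProperties
import Relation.Binary.Reasoning.PartialOrder as ≤-Reasoning

-- Passing from I^j to one of its children shrinks the gap of the j-th entry (hole-decrease),
-- so every comparability inequality with I^j on the right-hand side survives, and leaves the
-- other lengths unchanged. For the inequalities with I^j on the left, the density ratio gives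
-- |child| ≥ x_j |g^j(I^j)| = x_j/(x_j+1) · (x_j+1)|g^j(I^j)|, and maximality of j bounds the
-- last factor below by (x_k+1)|g^k(I^k)|.

module OrderedFieldProperties (F : OrderedField) where
  open OrderedField F

  commutativeRing : CommutativeRing _ _
  commutativeRing = record { isCommutativeRing = isCommutativeRing }

  open CommutativeRing commutativeRing public
    using (+-assoc; +-identityˡ; +-identityʳ; -‿inverseˡ; -‿inverseʳ;
           *-comm; *-assoc; *-identityˡ; *-identityʳ; ring)
  open RingProperties ring public
    using (-‿distribˡ-*; -‿distribʳ-*; -‿involutive; x[y-z]≈xy-xz; x∙y⁻¹≈ε⇒x≈y)
  open IsTotalOrder isTotalOrder public
    using (antisym; total) renaming (refl to ≤-refl; trans to ≤-trans)

  poset : Poset _ _ _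
  poset = record { isPartialOrder = IsTotalOrder.isPartialOrder isTotalOrder }

  open ≤-Reasoning poset

  x≤y⇒0≤y-x : ∀ {x y} → x ≤ y → 0# ≤ y - x
  x≤y⇒0≤y-x {x} {y} x≤y = begin
    0#     ≡⟨ -‿inverseʳ x ⟨
    x - x  ≤⟨ +-mono-≤ (- x) x≤y ⟩
    y - x  ∎

  0≤y-x⇒x≤y : ∀ {x y} → 0# ≤ y - x → x ≤ y
  0≤y-x⇒x≤y {x} {y} 0≤y-x = begin
    x             ≡⟨ +-identityˡ x ⟨
    0# + x        ≤⟨ +-mono-≤ x 0≤y-x ⟩
    y - x + x     ≡⟨ +-assoc y (- x) x ⟩
    y + (- x + x) ≡⟨ cong (y +_) (-‿inverseˡ x) ⟩
    y + 0#        ≡⟨ +-identityʳ y ⟩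
    y             ∎

  x≤0⇒0≤-x : ∀ {x} → x ≤ 0# → 0# ≤ - x
  x≤0⇒0≤-x {x} x≤0 = begin
    0#       ≤⟨ x≤y⇒0≤y-x x≤0 ⟩
    0# - x   ≡⟨ +-identityˡ (- x) ⟩
    - x      ∎

  x<y⇒y-x≢0 : ∀ {x y} → x < y → y - x ≢ 0#
  x<y⇒y-x≢0 {x} {y} (_ , x≢y) y-x≡0 = x≢y (sym (x∙y⁻¹≈ε⇒x≈y y x y-x≡0))

  *-monoʳ-≤-nonNeg : ∀ {a b c} → 0# ≤ a → b ≤ c → a * b ≤ a * c
  *-monoʳ-≤-nonNeg {a} {b} {c} 0≤a b≤c = 0≤y-x⇒x≤y (begin
    0#              ≤⟨ *-nonneg 0≤a (x≤y⇒0≤y-x b≤c) ⟩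
    a * (c - b)     ≡⟨ x[y-z]≈xy-xz a c b ⟩
    a * c - a * b   ∎)

  *-monoˡ-≤-nonNeg : ∀ {a b c} → 0# ≤ a → b ≤ c → b * a ≤ c * a
  *-monoˡ-≤-nonNeg {a} {b} {c} 0≤a b≤c = begin
    b * a  ≡⟨ *-comm b a ⟩
    a * b  ≤⟨ *-monoʳ-≤-nonNeg 0≤a b≤c ⟩
    a * c  ≡⟨ *-comm a c ⟩
    c * a  ∎

  -x*-y≡x*y : ∀ x y → - x * - y ≡ x * y
  -x*-y≡x*y x y = begin-equality
    - x * - y        ≡⟨ -‿distribˡ-* x (- y) ⟨
    - (x * - y)      ≡⟨ cong -_ (-‿distribʳ-* x y) ⟨
    - (- (x * y))    ≡⟨ -‿involutive (x * y) ⟩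
    x * y            ∎

  0≤x*x : ∀ x → 0# ≤ x * x
  0≤x*x x with total 0# x
  ... | inj₁ 0≤x = *-nonneg 0≤x 0≤x
  ... | inj₂ x≤0 = begin
    0#         ≤⟨ *-nonneg (x≤0⇒0≤-x x≤0) (x≤0⇒0≤-x x≤0) ⟩
    - x * - x  ≡⟨ -x*-y≡x*y x x ⟩
    x * x      ∎

  0≤1 : 0# ≤ 1#
  0≤1 = begin
    0#       ≤⟨ 0≤x*x 1# ⟩
    1# * 1#  ≡⟨ *-identityˡ 1# ⟩
    1#       ∎

  0≤x⇒1≤x+1 : ∀ {x} → 0# ≤ x → 1# ≤ x + 1#
  0≤x⇒1≤x+1 {x} 0≤x = begin
    1#       ≡⟨ +-identityˡ 1# ⟨
    0# + 1#  ≤⟨ +-mono-≤ 1# 0≤x ⟩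
    x + 1#   ∎

  0≤x⇒0≤x+1 : ∀ {x} → 0# ≤ x → 0# ≤ x + 1#
  0≤x⇒0≤x+1 0≤x = ≤-trans 0≤1 (0≤x⇒1≤x+1 0≤x)

  0≤x⇒x+1≢0 : ∀ {x} → 0# ≤ x → x + 1# ≢ 0#
  0≤x⇒x+1≢0 {x} 0≤x x+1≡0 = 0≢1 (antisym 0≤1 (begin
    1#      ≤⟨ 0≤x⇒1≤x+1 0≤x ⟩
    x + 1#  ≡⟨ x+1≡0 ⟩
    0#      ∎))

  x*y⁻¹*y≡x : ∀ x {y} → y ≢ 0# → x * y ⁻¹ * y ≡ x
  x*y⁻¹*y≡x x {y} y≢0 = begin-equality
    x * y ⁻¹ * y    ≡⟨ *-assoc x (y ⁻¹) y ⟩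
    x * (y ⁻¹ * y)  ≡⟨ cong (x *_) (*-comm (y ⁻¹) y) ⟩
    x * (y * y ⁻¹)  ≡⟨ cong (x *_) (*-inverse y y≢0) ⟩
    x * 1#          ≡⟨ *-identityʳ x ⟩
    x               ∎

  ⁻¹-nonNeg : ∀ {a} → 0# ≤ a → a ≢ 0# → 0# ≤ a ⁻¹
  ⁻¹-nonNeg {a} 0≤a a≢0 = begin
    0#                   ≤⟨ *-nonneg 0≤a (0≤x*x (a ⁻¹)) ⟩
    a * (a ⁻¹ * a ⁻¹)    ≡⟨ *-assoc a (a ⁻¹) (a ⁻¹) ⟨
    a * a ⁻¹ * a ⁻¹      ≡⟨ cong (_* a ⁻¹) (*-inverse a a≢0) ⟩
    1# * a ⁻¹            ≡⟨ *-identityˡ (a ⁻¹) ⟩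
    a ⁻¹                 ∎

  ≤*⁻¹⇒*≤ : ∀ {x y z} → 0# ≤ z → z ≢ 0# → x ≤ y * z ⁻¹ → x * z ≤ y
  ≤*⁻¹⇒*≤ {x} {y} {z} 0≤z z≢0 x≤y/z = begin
    x * z           ≤⟨ *-monoˡ-≤-nonNeg 0≤z x≤y/z ⟩
    y * z ⁻¹ * z    ≡⟨ x*y⁻¹*y≡x y z≢0 ⟩
    y               ∎

module CantorSetProperties (F : OrderedField) where
  open OF F
  open OrderedFieldProperties F
  open ≤-Reasoning poset

  frac-nonNeg : ∀ {x} → 0# ≤ x → 0# ≤ frac x
  frac-nonNeg 0≤x = *-nonneg 0≤x (⁻¹-nonNeg (0≤x⇒0≤x+1 0≤x) (0≤x⇒x+1≢0 0≤x))

  frac*[x+1]≡x : ∀ {x} → 0# ≤ x → frac x * (x + 1#) ≡ x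
  frac*[x+1]≡x {x} 0≤x = x*y⁻¹*y≡x x (0≤x⇒x+1≢0 0≤x)

  gapLen-nonNeg : ∀ C {i} → 1 ℕ.≤ i → 0# ≤ gapLen C i
  gapLen-nonNeg C i≥1 = x≤y⇒0≤y-x (proj₁ (proj₁ (proj₂ (ordered C _ i≥1))))

  gapLen≢0 : ∀ C {i} → 1 ℕ.≤ i → gapLen C i ≢ 0#
  gapLen≢0 C i≥1 = x<y⇒y-x≢0 (proj₁ (proj₂ (ordered C _ i≥1)))

  DrAtLeast⇒*gapLen≤len-children : ∀ C {x} → DrAtLeast C x → ∀ {i} → 1 ℕ.≤ i →
    (x * gapLen C i ≤ len C (2 ℕ.* i)) × (x * gapLen C i ≤ len C (ℕ.suc (2 ℕ.* i)))
  DrAtLeast⇒*gapLen≤len-children C {x} dr {i} i≥1 =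
    Product.map ≤/gapLen⇒*gapLen≤ ≤/gapLen⇒*gapLen≤ (dr i i≥1)
    where
    ≤/gapLen⇒*gapLen≤ : ∀ {l} → x ≤ l * gapLen C i ⁻¹ → x * gapLen C i ≤ l
    ≤/gapLen⇒*gapLen≤ = ≤*⁻¹⇒*≤ (gapLen-nonNeg C i≥1) (gapLen≢0 C i≥1)

  comparable-update : ∀ {n} (C : Fin n → CantorSet) (x : Fin n → Carrier)
    {idx : Fin n → ℕ} {j : Fin n} {m : ℕ} →
    (∀ k → 0# ≤ x k) →
    Comparable C x idx →
    (∀ k → (x k + 1#) * gapLen (C k) (idx k) ≤ (x j + 1#) * gapLen (C j) (idx j)) →
    gapLen (C j) m ≤ gapLen (C j) (idx j) →
    x j * gapLen (C j) (idx j) ≤ len (C j) m →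
    Comparable C x (update idx j m)
  comparable-update {n} C x {idx} {j} {m} 0≤x comparable j-maximal gap-shrinks m-long a b = begin
    frac (x a) * (x b + 1#) * gapLen (C b) (idx′ b)  ≤⟨ *-monoʳ-≤-nonNeg coefficient-nonNeg (gap-≤ b) ⟩
    frac (x a) * (x b + 1#) * gapLen (C b) (idx b)   ≤⟨ len-≥ a ⟩
    len (C a) (idx′ a)                               ∎
    where
    idx′ : Fin n → ℕ
    idx′ = update idx j m

    coefficient-nonNeg : 0# ≤ frac (x a) * (x b + 1#)
    coefficient-nonNeg = *-nonneg (frac-nonNeg (0≤x a)) (0≤x⇒0≤x+1 (0≤x b))

    gap-≤ : ∀ k → gapLen (C k) (idx′ k) ≤ gapLen (C k) (idx k)
    gap-≤ k with k ≟ j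
    ... | yes refl = gap-shrinks
    ... | no _     = ≤-refl

    len-≥ : ∀ k → frac (x k) * (x b + 1#) * gapLen (C b) (idx b) ≤ len (C k) (idx′ k)
    len-≥ k with k ≟ j
    ... | no _     = comparable k b
    ... | yes refl = begin
      frac (x j) * (x b + 1#) * gapLen (C b) (idx b)    ≡⟨ *-assoc (frac (x j)) _ _ ⟩
      frac (x j) * ((x b + 1#) * gapLen (C b) (idx b))  ≤⟨ *-monoʳ-≤-nonNeg (frac-nonNeg (0≤x j)) (j-maximal b) ⟩
      frac (x j) * ((x j + 1#) * gapLen (C j) (idx j))  ≡⟨ *-assoc (frac (x j)) _ _ ⟨
      frac (x j) * (x j + 1#) * gapLen (C j) (idx j)    ≡⟨ cong (_* gapLen (C j) (idx j)) (frac*[x+1]≡x (0≤x j)) ⟩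
      x j * gapLen (C j) (idx j)                        ≤⟨ m-long ⟩
      len (C j) m                                       ∎

-- The hypotheses on n, on the sum of the x_j/(x_j+1) and on the initial intervals are standing
-- assumptions of the paper that this step does not use.
lemma3p6 : (F : OrderedField) → let open OF F in
    (n : ℕ) → 2 ℕ.≤ n →
    (C : Fin n → CantorSet) → (x : Fin n → Carrier) →
    (∀ j → HoleDecreasing (C j)) →
    (∀ j → 0# ≤ x j) →
    (∀ j → DrAtLeast (C j) (x j)) →
    1# ≤ sumFin n (λ j → frac (x j)) →
    (∀ j k → frac (x j) * (x k + 1#) * len (C k) 1 ≤ len (C j) 1) →
    (idx : Fin n → ℕ) → (∀ j → 1 ℕ.≤ idx j) →
    Comparable C x idx →
    (j : Fin n) →
    (∀ k → (x k + 1#) * gapLen (C k) (idx k) ≤ (x j + 1#) * gapLen (C j) (idx j)) →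
    Dividable C x idx j
lemma3p6 F n _ C x holeDecreasing 0≤x dr _ _ idx idx≥1 comparable j j-maximal =
  divideInto (proj₁ gapsShrink) (proj₁ childrenLong) ,
  divideInto (proj₂ gapsShrink) (proj₂ childrenLong)
  where
  open OF F
  open CantorSetProperties F

  divideInto : ∀ {m} → gapLen (C j) m ≤ gapLen (C j) (idx j) →
    x j * gapLen (C j) (idx j) ≤ len (C j) m → Comparable C x (update idx j m)
  divideInto = comparable-update C x 0≤x comparable j-maximal

  gapsShrink : (gapLen (C j) (2 ℕ.* idx j) ≤ gapLen (C j) (idx j)) ×
               (gapLen (C j) (ℕ.suc (2 ℕ.* idx j)) ≤ gapLen (C j) (idx j))
  gapsShrink = holeDecreasing j (idx j) (idx≥1 j)

  childrenLong : (x j * gapLen (C j) (idx j) ≤ len (C j) (2 ℕ.* idx j)) ×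
                 (x j * gapLen (C j) (idx j) ≤ len (C j) (ℕ.suc (2 ℕ.* idx j)))
  childrenLong = DrAtLeast⇒*gapLen≤len-children (C j) (dr j) (idx≥1 j)
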